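{- For every positive integer $k$, $$H_k(q;a,b,c,d)=\sum_{j=0}^{k+1}\frac{u_j(a,b,c,d)\,q^{\binom{k+1-j}{2}}}{(q;q)_{k+1-j}},$$ where for all $n\ge0$ $$u_{2n}(a,b,c,d)=(1-b)\sum_{\ell=0}^{n}\frac{(-aq^{2\ell+1};q^2)_{n-\ell}(-dq^{2\ell+1};q^2)_{n-\ell}}{(bq^{2\ell};q^2)_{n-\ell+1}(cq^{2\ell+1};q^2)_{n-\ell}}\frac{q^{2\ell}}{(q;q)_{2\ell}},$$ $$u_{2n+1}(a,b,c,d)=(b-1)\sum_{\ell=0}^{n}\frac{(-aq^{2\ell+2};q^2)_{n-\ell}(-dq^{2\ell+2};q^2)_{n-\ell}}{(bq^{2\ell+1};q^2)_{n-\ell+1}(cq^{2\ell+2};q^2)_{n-\ell}}\frac{q^{2\ell+1}}{(q;q)_{2\ell+1}}.$$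
   Context: $(x;q)_n=\prod_{i=0}^{n-1}(1-xq^i)$. The sequence $(H_k(q;a,b,c,d))_{k\ge-3}$ of rational functions is defined by $H_{ -1}=1$, $H_{ -2}=0$, $H_{ -3}=\frac{(b-1)cq}{ad}$ and, for $k\ge0$, $$(1-cq^k)(1-bq^{k+1})H_k=(1-bcq^{2k})H_{k-1}+(aq^k+dq^k+adq^{2k})H_{k-2}+adq^{2k-1}H_{k-3}.$$ (In particular $H_0=\frac{1}{1-bq}$ and $H_1=\frac{1-bcq^2}{(1-cq)(1-bq)(1-bq^2)}+\frac{aq+dq+adq^2}{(1-cq)(1-bq^2)}$.) -}

module Defs where

open import Data.Nat as ℕ using (ℕ; zero; suc; _∸_; ⌊_/2⌋)
open import Data.Nat.Combinatorics using (_C_)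
open import Data.Bool using (Bool; true; false; not; if_then_else_)
open import Data.Rational using (ℚ; 0ℚ; 1ℚ; _+_; _*_; _-_; -_; 1/_; ≢-nonZero)
open import Data.Rational.Properties using (_≟_)
open import Relation.Nullary using (yes; no)

_^_ : ℚ → ℕ → ℚ
x ^ zero  = 1ℚ
x ^ suc n = x * (x ^ n)


-- total inverse (inv 0 = 0); only ever applied to nonzero arguments
-- under the hypotheses of the theorem
inv : ℚ → ℚ
inv x with x ≟ 0ℚ
... | yes _  = 0ℚ
... | no x≢0 = 1/_ x {{≢-nonZero x≢0}}

poch : ℚ → ℚ → ℕ → ℚ
poch x p zero    = 1ℚ
poch x p (suc n) = poch x p n * (1ℚ - x * (p ^ n))

sumTo : ℕ → (ℕ → ℚ) → ℚ
sumTo zero    f = f 0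
sumTo (suc n) f = sumTo n f + f (suc n)

q2k-1 : ℚ → ℕ → ℚ
q2k-1 q zero    = inv q
q2k-1 q (suc k) = q ^ (suc (2 ℕ.* k))

-- Hsh q a b c d m = H_{m-3}(q;a,b,c,d)   (index shifted by 3)
Hsh : ℚ → ℚ → ℚ → ℚ → ℚ → ℕ → ℚ
Hsh q a b c d zero = (b - 1ℚ) * c * q * inv (a * d)
Hsh q a b c d (suc zero) = 0ℚ
Hsh q a b c d (suc (suc zero)) = 1ℚ
Hsh q a b c d (suc (suc (suc k))) =
  inv ((1ℚ - c * (q ^ k)) * (1ℚ - b * (q ^ suc k))) *
    ( (1ℚ - b * c * (q ^ (2 ℕ.* k))) * Hsh q a b c d (suc (suc k))
    + (a * (q ^ k) + d * (q ^ k) + a * d * (q ^ (2 ℕ.* k))) * Hsh q a b c d (suc k)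
    + a * d * q2k-1 q k * Hsh q a b c d k )

H : ℚ → ℚ → ℚ → ℚ → ℚ → ℕ → ℚ
H q a b c d k = Hsh q a b c d (3 ℕ.+ k)

uEven : ℚ → ℚ → ℚ → ℚ → ℚ → ℕ → ℚ
uEven q a b c d n = (1ℚ - b) * sumTo n (λ ℓ →
    poch (- a * (q ^ (2 ℕ.* ℓ ℕ.+ 1))) (q ^ 2) (n ∸ ℓ)
  * poch (- d * (q ^ (2 ℕ.* ℓ ℕ.+ 1))) (q ^ 2) (n ∸ ℓ)
  * inv ( poch (b * (q ^ (2 ℕ.* ℓ))) (q ^ 2) (suc (n ∸ ℓ))
        * poch (c * (q ^ (2 ℕ.* ℓ ℕ.+ 1))) (q ^ 2) (n ∸ ℓ))
  * (q ^ (2 ℕ.* ℓ)) * inv (poch q q (2 ℕ.* ℓ)))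

uOdd : ℚ → ℚ → ℚ → ℚ → ℚ → ℕ → ℚ
uOdd q a b c d n = (b - 1ℚ) * sumTo n (λ ℓ →
    poch (- a * (q ^ (2 ℕ.* ℓ ℕ.+ 2))) (q ^ 2) (n ∸ ℓ)
  * poch (- d * (q ^ (2 ℕ.* ℓ ℕ.+ 2))) (q ^ 2) (n ∸ ℓ)
  * inv ( poch (b * (q ^ (2 ℕ.* ℓ ℕ.+ 1))) (q ^ 2) (suc (n ∸ ℓ))
        * poch (c * (q ^ (2 ℕ.* ℓ ℕ.+ 2))) (q ^ 2) (n ∸ ℓ))
  * (q ^ (2 ℕ.* ℓ ℕ.+ 1)) * inv (poch q q (2 ℕ.* ℓ ℕ.+ 1)))

isEven : ℕ → Bool
isEven zero    = true
isEven (suc n) = not (isEven n)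

u : ℚ → ℚ → ℚ → ℚ → ℚ → ℕ → ℚ
u q a b c d j = if isEven j then uEven q a b c d ⌊ j /2⌋ else uOdd q a b c d ⌊ j /2⌋

RHS : ℚ → ℚ → ℚ → ℚ → ℚ → ℕ → ℚ
RHS q a b c d k = sumTo (suc k) (λ j →
  u q a b c d j * (q ^ ((suc k ∸ j) C 2)) * inv (poch q q (suc k ∸ j)))

{-# OPTIONS --safe #-}
module Submission where

-- Let e_m = q^(m choose 2)/(q;q)_m be the coefficients of Euler's product (-z;q)_∞ and
-- s = e ⋆ u the convolution of e with the sequence u, so that the right-hand side is s_{k+1}.
-- Since (-z;q)_∞ = (1 + z)(-qz;q)_∞, convolution with e turns the dilation f_j ↦ q^j f_j into
-- (1 + shift) ∘ dilation.  Passing from u_{j} to u_{j+2} multiplies every summand by the same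
-- factor, independent of ℓ, which gives a two-step recurrence for u; convolving it shows that the defect
-- of the H-recurrence on s plus the same defect one index lower is a combination of e ⋆ v and
-- its dilation, where v_j = (-1)^j q^j/(q;q)_j.  By Euler again e ⋆ v = 1 + z, so this vanishes
-- from index 3 on, and the initial values force s_{k+1} to satisfy the recurrence of H_k.

open import Data.Bool.Base using (Bool; true; false; if_then_else_)
open import Data.Bool.Properties using (not-involutive)
open import Data.Empty using (⊥-elim)
open import Data.Maybe.Base using (Maybe; just; nothing)
open import Data.Nat as ℕ using (ℕ; zero; suc; _≤_; _∸_; ⌊_/2⌋)
import Data.Nat.Properties as ℕₚ
open import Data.Nat.Combinatorics using (_C_; nCk+nC[k+1]≡[n+1]C[k+1]; nC1≡n)
import Data.Nat.Tactic.RingSolver as ℕ-Solver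
open import Data.Rational using (ℚ; 0ℚ; 1ℚ; _+_; _*_; _-_; -_; ≢-nonZero)
open import Data.Rational.Properties
  using (_≟_; +-*-commutativeRing; *-inverseʳ; +-assoc; +-identityˡ; *-assoc; *-comm; *-identityˡ; *-identityʳ;
         *-distribˡ-+; *-zeroˡ; *-zeroʳ)
open import Level using (0ℓ)
open import Relation.Nullary using (Dec; yes; no)
open import Relation.Binary.PropositionalEquality
open import Tactic.RingSolver using (solve-∀)
import Tactic.RingSolver.Core.AlmostCommutativeRing as ACR

open import Defs

open ≡-Reasoning

ℚ-ring : ACR.AlmostCommutativeRing 0ℓ 0ℓ
ℚ-ring = ACR.fromCommutativeRing +-*-commutativeRing isZero
  where
  isZero : ∀ x → Maybe (0ℚ ≡ x)
  isZero x with x ≟ 0ℚ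
  ... | yes x≡0 = just (sym x≡0)
  ... | no _    = nothing

inv-inverseʳ : ∀ {x} → x ≢ 0ℚ → x * inv x ≡ 1ℚ
inv-inverseʳ {x} x≢0 with x ≟ 0ℚ
... | yes x≡0  = ⊥-elim (x≢0 x≡0)
... | no  x≢0′ = *-inverseʳ x {{≢-nonZero x≢0′}}

inv-cancelˡ : ∀ {x} y → x ≢ 0ℚ → x * (y * inv x) ≡ y
inv-cancelˡ {x} y x≢0 = begin
  x * (y * inv x)  ≡⟨ swap x y (inv x) ⟩
  y * (x * inv x)  ≡⟨ cong (y *_) (inv-inverseʳ x≢0) ⟩
  y * 1ℚ           ≡⟨ *-identityʳ y ⟩
  y                ∎
  where
  swap : ∀ x y z → x * (y * z) ≡ y * (x * z)
  swap = solve-∀ ℚ-ring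

*-cancelˡ : ∀ {x y z} → x ≢ 0ℚ → x * y ≡ x * z → y ≡ z
*-cancelˡ {x} {y} {z} x≢0 xy≡xz = begin
  y                ≡⟨ sym (inv-cancelˡ y x≢0) ⟩
  x * (y * inv x)  ≡⟨ sym (*-assoc x y (inv x)) ⟩
  x * y * inv x    ≡⟨ cong (_* inv x) xy≡xz ⟩
  x * z * inv x    ≡⟨ *-assoc x z (inv x) ⟩
  x * (z * inv x)  ≡⟨ inv-cancelˡ z x≢0 ⟩
  z                ∎

*-≢0 : ∀ {x y} → x ≢ 0ℚ → y ≢ 0ℚ → x * y ≢ 0ℚ
*-≢0 {x} {y} x≢0 y≢0 xy≡0 = x≢0 (begin
  x                ≡⟨ sym (inv-cancelˡ x y≢0) ⟩
  y * (x * inv y)  ≡⟨ regroup x y (inv y) ⟩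
  x * y * inv y    ≡⟨ cong (_* inv y) xy≡0 ⟩
  0ℚ * inv y       ≡⟨ *-zeroˡ (inv y) ⟩
  0ℚ               ∎)
  where
  regroup : ∀ x y z → y * (x * z) ≡ x * y * z
  regroup = solve-∀ ℚ-ring

inv-unique : ∀ {x y} → x * y ≡ 1ℚ → inv x ≡ y
inv-unique {x} {y} xy≡1 = *-cancelˡ x≢0 (trans (inv-inverseʳ x≢0) (sym xy≡1))
  where
  x≢0 : x ≢ 0ℚ
  x≢0 refl with trans (sym (*-zeroˡ y)) xy≡1
  ... | ()

inv-* : ∀ x y → inv (x * y) ≡ inv x * inv y
inv-* x y = by-cases (x ≟ 0ℚ) (y ≟ 0ℚ)
  where
  regroup : ∀ x y x′ y′ → x * y * (x′ * y′) ≡ x * x′ * (y * y′)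
  regroup = solve-∀ ℚ-ring
  by-cases : Dec (x ≡ 0ℚ) → Dec (y ≡ 0ℚ) → inv (x * y) ≡ inv x * inv y
  by-cases (yes refl) _          = trans (cong inv (*-zeroˡ y)) (sym (*-zeroˡ (inv y)))
  by-cases (no _)     (yes refl) = trans (cong inv (*-zeroʳ x)) (sym (*-zeroʳ (inv x)))
  by-cases (no x≢0)   (no y≢0)   = inv-unique {x * y} {inv x * inv y} (begin
    x * y * (inv x * inv y)  ≡⟨ regroup x y (inv x) (inv y) ⟩
    x * inv x * (y * inv y)  ≡⟨ cong₂ _*_ (inv-inverseʳ x≢0) (inv-inverseʳ y≢0) ⟩
    1ℚ * 1ℚ                  ≡⟨⟩
    1ℚ                       ∎)

*-solveˡ : ∀ {x y z} → x ≢ 0ℚ → x * y ≡ z → y ≡ inv x * z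
*-solveˡ {x} {y} {z} x≢0 xy≡z = *-cancelˡ x≢0 (begin
  x * y              ≡⟨ xy≡z ⟩
  z                  ≡⟨ sym (inv-cancelˡ z x≢0) ⟩
  x * (z * inv x)    ≡⟨ cong (x *_) (*-comm z (inv x)) ⟩
  x * (inv x * z)    ∎)

x+y≡z⇒x≡z-y : ∀ {x y z} → x + y ≡ z → x ≡ z - y
x+y≡z⇒x≡z-y {x} {y} x+y≡z = trans (isolate x y) (cong (_- y) x+y≡z)
  where
  isolate : ∀ x y → x ≡ (x + y) - y
  isolate = solve-∀ ℚ-ring

^-distribˡ-+-* : ∀ x m n → x ^ (m ℕ.+ n) ≡ x ^ m * x ^ n
^-distribˡ-+-* x zero    n = sym (*-identityˡ (x ^ n))
^-distribˡ-+-* x (suc m) n = trans (cong (x *_) (^-distribˡ-+-* x m n)) (sym (*-assoc x (x ^ m) (x ^ n)))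

^-*-assoc : ∀ x m n → (x ^ m) ^ n ≡ x ^ (m ℕ.* n)
^-*-assoc x m zero    = cong (x ^_) (sym (ℕₚ.*-zeroʳ m))
^-*-assoc x m (suc n) = begin
  x ^ m * (x ^ m) ^ n      ≡⟨ cong (x ^ m *_) (^-*-assoc x m n) ⟩
  x ^ m * x ^ (m ℕ.* n)    ≡⟨ sym (^-distribˡ-+-* x m (m ℕ.* n)) ⟩
  x ^ (m ℕ.+ m ℕ.* n)      ≡⟨ cong (x ^_) (sym (ℕₚ.*-suc m n)) ⟩
  x ^ (m ℕ.* suc n)        ∎

^-double : ∀ x n → x ^ (2 ℕ.* n) ≡ x ^ n * x ^ n
^-double x n = trans (cong (λ k → x ^ (n ℕ.+ k)) (ℕₚ.+-identityʳ n)) (^-distribˡ-+-* x n n)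

^-geometric : ∀ x y e m {n} → e ℕ.+ 2 ℕ.* m ≡ n → x * y ^ e * (y ^ 2) ^ m ≡ x * y ^ n
^-geometric x y e m refl = begin
  x * y ^ e * (y ^ 2) ^ m      ≡⟨ *-assoc x (y ^ e) ((y ^ 2) ^ m) ⟩
  x * (y ^ e * (y ^ 2) ^ m)    ≡⟨ cong (λ z → x * (y ^ e * z)) (^-*-assoc y 2 m) ⟩
  x * (y ^ e * y ^ (2 ℕ.* m))  ≡⟨ cong (x *_) (sym (^-distribˡ-+-* y e (2 ℕ.* m))) ⟩
  x * y ^ (e ℕ.+ 2 ℕ.* m)      ∎

twice-split : ∀ {ℓ n} → ℓ ≤ n → 2 ℕ.* ℓ ℕ.+ 2 ℕ.* (n ∸ ℓ) ≡ 2 ℕ.* n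
twice-split {ℓ} {n} ℓ≤n = trans (sym (ℕₚ.*-distribˡ-+ 2 ℓ (n ∸ ℓ))) (cong (2 ℕ.*_) (ℕₚ.m+[n∸m]≡n ℓ≤n))

sumTo-cong : ∀ n {f g : ℕ → ℚ} → (∀ j → j ≤ n → f j ≡ g j) → sumTo n f ≡ sumTo n g
sumTo-cong zero    f≗g = f≗g 0 ℕ.z≤n
sumTo-cong (suc n) f≗g =
  cong₂ _+_ (sumTo-cong n (λ j j≤n → f≗g j (ℕₚ.m≤n⇒m≤1+n j≤n))) (f≗g (suc n) ℕₚ.≤-refl)

sumTo-+ : ∀ n (f g : ℕ → ℚ) → sumTo n (λ j → f j + g j) ≡ sumTo n f + sumTo n g
sumTo-+ zero    f g = refl
sumTo-+ (suc n) f g =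
  trans (cong (_+ (f (suc n) + g (suc n))) (sumTo-+ n f g)) (interchange (sumTo n f) (sumTo n g) (f (suc n)) (g (suc n)))
  where
  interchange : ∀ x y z w → (x + y) + (z + w) ≡ (x + z) + (y + w)
  interchange = solve-∀ ℚ-ring

sumTo-*ˡ : ∀ n α (f : ℕ → ℚ) → sumTo n (λ j → α * f j) ≡ α * sumTo n f
sumTo-*ˡ zero    α f = refl
sumTo-*ˡ (suc n) α f =
  trans (cong (_+ α * f (suc n)) (sumTo-*ˡ n α f)) (sym (*-distribˡ-+ α (sumTo n f) (f (suc n))))

sumTo-head : ∀ n (f : ℕ → ℚ) → sumTo (suc n) f ≡ f 0 + sumTo n (λ j → f (suc j))
sumTo-head zero    f = refl
sumTo-head (suc n) f =
  trans (cong (_+ f (suc (suc n))) (sumTo-head n f)) (+-assoc (f 0) (sumTo n (λ j → f (suc j))) (f (suc (suc n))))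

isEven-suc-suc : ∀ i → isEven (suc (suc i)) ≡ isEven i
isEven-suc-suc i = not-involutive (isEven i)

even-half : ∀ i → isEven i ≡ true → 2 ℕ.* ⌊ i /2⌋ ≡ i
even-half zero          _    = refl
even-half (suc zero)    ()
even-half (suc (suc i)) even =
  trans (ℕₚ.*-suc 2 ⌊ i /2⌋) (cong (2 ℕ.+_) (even-half i (trans (sym (isEven-suc-suc i)) even)))

odd-half : ∀ i → isEven i ≡ false → suc (2 ℕ.* ⌊ i /2⌋) ≡ i
odd-half zero          ()
odd-half (suc zero)    _   = refl
odd-half (suc (suc i)) odd =
  trans (cong suc (ℕₚ.*-suc 2 ⌊ i /2⌋)) (cong (2 ℕ.+_) (odd-half i (trans (sym (isEven-suc-suc i)) odd)))

-1*-1*x≡x : ∀ x → (- 1ℚ) * ((- 1ℚ) * x) ≡ x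
-1*-1*x≡x = solve-∀ ℚ-ring

sign-even : ∀ i → isEven i ≡ true → (- 1ℚ) ^ i ≡ 1ℚ
sign-even zero          _    = refl
sign-even (suc zero)    ()
sign-even (suc (suc i)) even = trans (-1*-1*x≡x _) (sign-even i (trans (sym (isEven-suc-suc i)) even))

sign-odd : ∀ i → isEven i ≡ false → (- 1ℚ) ^ i ≡ - 1ℚ
sign-odd zero          ()
sign-odd (suc zero)    _   = refl
sign-odd (suc (suc i)) odd = trans (-1*-1*x≡x _) (sign-odd i (trans (sym (isEven-suc-suc i)) odd))

module EulerConvolution (q : ℚ) (1-qⁱ⁺¹≢0 : ∀ i → 1ℚ - q ^ suc i ≢ 0ℚ) where

  euler : ℕ → ℚ
  euler m = q ^ (m C 2) * inv (poch q q m)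

  conv : (ℕ → ℚ) → ℕ → ℚ
  conv f n = sumTo n (λ j → f j * euler (n ∸ j))

  shift : (ℕ → ℚ) → ℕ → ℚ
  shift f zero    = 0ℚ
  shift f (suc n) = f n

  dilate : (ℕ → ℚ) → ℕ → ℚ
  dilate f n = q ^ n * f n

  euler-suc : ∀ t → (1ℚ - q ^ suc t) * euler (suc t) ≡ q ^ t * euler t
  euler-suc t = begin
    X * euler (suc t)                                    ≡⟨ cong (X *_) unfold ⟩
    X * (q ^ t * euler t * inv X)                        ≡⟨ inv-cancelˡ (q ^ t * euler t) (1-qⁱ⁺¹≢0 t) ⟩
    q ^ t * euler t                                      ∎
    where
    X = 1ℚ - q ^ suc t
    [t+1]C2 : suc t C 2 ≡ t ℕ.+ t C 2
    [t+1]C2 = trans (sym (nCk+nC[k+1]≡[n+1]C[k+1] t 1)) (cong (ℕ._+ t C 2) (nC1≡n t))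
    regroup : ∀ x y z w → x * y * (z * w) ≡ x * (y * z) * w
    regroup = solve-∀ ℚ-ring
    unfold : euler (suc t) ≡ q ^ t * euler t * inv X
    unfold = begin
      q ^ (suc t C 2) * inv (poch q q t * X)
        ≡⟨ cong₂ _*_ (trans (cong (q ^_) [t+1]C2) (^-distribˡ-+-* q t (t C 2))) (inv-* (poch q q t) X) ⟩
      q ^ t * q ^ (t C 2) * (inv (poch q q t) * inv X)
        ≡⟨ regroup (q ^ t) _ _ _ ⟩
      q ^ t * euler t * inv X ∎

  q^j*euler : ∀ {j M} → j ≤ M →
    q ^ j * euler (suc M ∸ j) ≡ q ^ suc M * euler (suc M ∸ j) + q ^ M * euler (M ∸ j)
  q^j*euler {j} {M} j≤M rewrite ℕₚ.+-∸-assoc 1 j≤M = begin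
    q ^ j * euler (suc t)                                   ≡⟨ split (q ^ j) (q ^ suc t) (euler (suc t)) ⟩
    q ^ j * ((1ℚ - q ^ suc t) * euler (suc t)) + q ^ j * q ^ suc t * euler (suc t)
      ≡⟨ cong (λ x → q ^ j * x + q ^ j * q ^ suc t * euler (suc t)) (euler-suc t) ⟩
    q ^ j * (q ^ t * euler t) + q ^ j * q ^ suc t * euler (suc t)
      ≡⟨ regroup (q ^ j) (q ^ t) (euler t) _ ⟩
    q ^ j * q ^ suc t * euler (suc t) + q ^ j * q ^ t * euler t
      ≡⟨ cong₂ (λ x y → x * euler (suc t) + y * euler t) (q^j*q^ j (suc t) j+[1+t]≡1+M) (q^j*q^ j t j+t≡M) ⟩
    q ^ suc M * euler (suc t) + q ^ M * euler t             ∎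
    where
    t = M ∸ j
    j+t≡M : j ℕ.+ t ≡ M
    j+t≡M = ℕₚ.m+[n∸m]≡n j≤M
    j+[1+t]≡1+M : j ℕ.+ suc t ≡ suc M
    j+[1+t]≡1+M = trans (ℕₚ.+-suc j t) (cong suc j+t≡M)
    q^j*q^ : ∀ j k {n} → j ℕ.+ k ≡ n → q ^ j * q ^ k ≡ q ^ n
    q^j*q^ j k refl = sym (^-distribˡ-+-* q j k)
    split : ∀ x y e → x * e ≡ x * ((1ℚ - y) * e) + x * y * e
    split = solve-∀ ℚ-ring
    regroup : ∀ x y e z → x * (y * e) + z ≡ z + x * y * e
    regroup = solve-∀ ℚ-ring

  conv-cong : ∀ {f g : ℕ → ℚ} n → (∀ j → f j ≡ g j) → conv f n ≡ conv g n
  conv-cong n f≗g = sumTo-cong n (λ j _ → cong (_* euler (n ∸ j)) (f≗g j))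

  conv-+ : ∀ (f g : ℕ → ℚ) n → conv (λ j → f j + g j) n ≡ conv f n + conv g n
  conv-+ f g n = trans (sumTo-cong n (λ j _ → distrib (f j) (g j) (euler (n ∸ j)))) (sumTo-+ n _ _)
    where
    distrib : ∀ x y z → (x + y) * z ≡ x * z + y * z
    distrib = solve-∀ ℚ-ring

  conv-* : ∀ α (f : ℕ → ℚ) n → conv (λ j → α * f j) n ≡ α * conv f n
  conv-* α f n = trans (sumTo-cong n (λ j _ → *-assoc α (f j) (euler (n ∸ j)))) (sumTo-*ˡ n α _)

  conv-shift : ∀ f n → conv (shift f) n ≡ shift (conv f) n
  conv-shift f zero    = *-zeroˡ (euler 0)
  conv-shift f (suc n) = begin
    conv (shift f) (suc n)             ≡⟨ sumTo-head n _ ⟩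
    0ℚ * euler (suc n) + conv f n      ≡⟨ cong (_+ conv f n) (*-zeroˡ (euler (suc n))) ⟩
    0ℚ + conv f n                      ≡⟨ +-identityˡ (conv f n) ⟩
    conv f n                           ∎

  conv-dilate : ∀ f n → conv (dilate f) n ≡ dilate (conv f) n + shift (dilate (conv f)) n
  conv-dilate f zero    = regroup (f 0) (euler 0)
    where
    regroup : ∀ x e → 1ℚ * x * e ≡ 1ℚ * (x * e) + 0ℚ
    regroup = solve-∀ ℚ-ring
  conv-dilate f (suc M) = begin
    sumTo M (λ j → q ^ j * f j * euler (suc M ∸ j)) + q ^ suc M * f (suc M) * e₀
      ≡⟨ cong (_+ q ^ suc M * f (suc M) * e₀) (sumTo-cong M (λ j j≤M → termwise j j≤M)) ⟩
    sumTo M (λ j → q ^ suc M * (f j * euler (suc M ∸ j)) + q ^ M * (f j * euler (M ∸ j))) + q ^ suc M * f (suc M) * e₀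
      ≡⟨ cong (_+ q ^ suc M * f (suc M) * e₀) (sumTo-+ M _ _) ⟩
    (sumTo M (λ j → q ^ suc M * (f j * euler (suc M ∸ j))) + sumTo M (λ j → q ^ M * (f j * euler (M ∸ j))))
      + q ^ suc M * f (suc M) * e₀
      ≡⟨ cong₂ (λ x y → x + y + q ^ suc M * f (suc M) * e₀) (sumTo-*ˡ M (q ^ suc M) _) (sumTo-*ˡ M (q ^ M) _) ⟩
    q ^ suc M * S + q ^ M * conv f M + q ^ suc M * f (suc M) * e₀
      ≡⟨ regroup (q ^ suc M) (q ^ M) S (conv f M) (f (suc M)) e₀ ⟩
    q ^ suc M * (S + f (suc M) * e₀) + q ^ M * conv f M
      ∎
    where
    e₀ = euler (suc M ∸ suc M)
    S = sumTo M (λ j → f j * euler (suc M ∸ j))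
    termwise : ∀ j → j ≤ M →
      q ^ j * f j * euler (suc M ∸ j) ≡ q ^ suc M * (f j * euler (suc M ∸ j)) + q ^ M * (f j * euler (M ∸ j))
    termwise j j≤M = begin
      q ^ j * f j * euler (suc M ∸ j)      ≡⟨ swap (q ^ j) (f j) _ ⟩
      f j * (q ^ j * euler (suc M ∸ j))    ≡⟨ cong (f j *_) (q^j*euler j≤M) ⟩
      f j * (q ^ suc M * euler (suc M ∸ j) + q ^ M * euler (M ∸ j))
                                           ≡⟨ distrib (f j) (q ^ suc M) _ (q ^ M) _ ⟩
      q ^ suc M * (f j * euler (suc M ∸ j)) + q ^ M * (f j * euler (M ∸ j)) ∎
      where
      swap : ∀ x y e → x * y * e ≡ y * (x * e)
      swap = solve-∀ ℚ-ring
      distrib : ∀ y a e b e′ → y * (a * e + b * e′) ≡ a * (y * e) + b * (y * e′)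
      distrib = solve-∀ ℚ-ring
    regroup : ∀ Q Q′ S C x e → Q * S + Q′ * C + Q * x * e ≡ Q * (S + x * e) + Q′ * C
    regroup = solve-∀ ℚ-ring

  dilate-shift : ∀ f n → dilate (shift f) n ≡ q * shift (dilate f) n
  dilate-shift f zero    = trans (*-zeroʳ 1ℚ) (sym (*-zeroʳ q))
  dilate-shift f (suc n) = *-assoc q (q ^ n) (f n)

  conv-dilate² : ∀ f n → let F = dilate (dilate (conv f)) in
    conv (dilate (dilate f)) n ≡ F n + (1ℚ + q) * shift F n + q * shift (shift F) n
  conv-dilate² f n = trans (conv-dilate (dilate f) n) (collect n)
    where
    F = dilate (dilate (conv f))
    dilate-conv-dilate : ∀ m → dilate (conv (dilate f)) m ≡ F m + q * shift F m
    dilate-conv-dilate m = begin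
      q ^ m * conv (dilate f) m                                 ≡⟨ cong (q ^ m *_) (conv-dilate f m) ⟩
      q ^ m * (q ^ m * conv f m + shift (dilate (conv f)) m)    ≡⟨ *-distribˡ-+ (q ^ m) _ _ ⟩
      F m + dilate (shift (dilate (conv f))) m                  ≡⟨ cong (F m +_) (dilate-shift (dilate (conv f)) m) ⟩
      F m + q * shift F m                                       ∎
    collect : ∀ n → dilate (conv (dilate f)) n + shift (dilate (conv (dilate f))) n
                    ≡ F n + (1ℚ + q) * shift F n + q * shift (shift F) n
    collect zero    = trans (cong (_+ 0ℚ) (dilate-conv-dilate 0)) (regroup₀ q (F 0))
      where
      regroup₀ : ∀ q x → x + q * 0ℚ + 0ℚ ≡ x + (1ℚ + q) * 0ℚ + q * 0ℚ
      regroup₀ = solve-∀ ℚ-ring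
    collect (suc m) =
      trans (cong₂ _+_ (dilate-conv-dilate (suc m)) (dilate-conv-dilate m)) (regroup q (F (suc m)) (F m) (shift F m))
      where
      regroup : ∀ q x y z → x + q * y + (y + q * z) ≡ x + (1ℚ + q) * y + q * z
      regroup = solve-∀ ℚ-ring

  dilatePoly : ℚ → ℚ → ℚ → (ℕ → ℚ) → ℕ → ℚ
  dilatePoly α β γ f j = α * f j + β * dilate f j + γ * dilate (dilate f) j

  conv-dilatePoly : ∀ α β γ f n → let F = conv f in
    conv (dilatePoly α β γ f) n
      ≡ α * F n + β * (dilate F n + shift (dilate F) n)
        + γ * (dilate (dilate F) n + (1ℚ + q) * shift (dilate (dilate F)) n + q * shift (shift (dilate (dilate F))) n)
  conv-dilatePoly α β γ f n = begin
    conv (dilatePoly α β γ f) n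
      ≡⟨ conv-+ (λ j → α * f j + β * dilate f j) (λ j → γ * dilate (dilate f) j) n ⟩
    conv (λ j → α * f j + β * dilate f j) n + conv (λ j → γ * dilate (dilate f) j) n
      ≡⟨ cong (_+ _) (conv-+ (λ j → α * f j) (λ j → β * dilate f j) n) ⟩
    conv (λ j → α * f j) n + conv (λ j → β * dilate f j) n + conv (λ j → γ * dilate (dilate f) j) n
      ≡⟨ cong₂ _+_ (cong₂ _+_ (conv-* α f n) (conv-* β (dilate f) n)) (conv-* γ (dilate (dilate f)) n) ⟩
    α * conv f n + β * conv (dilate f) n + γ * conv (dilate (dilate f)) n
      ≡⟨ cong₂ (λ x y → α * conv f n + β * x + γ * y) (conv-dilate f n) (conv-dilate² f n) ⟩
    _ ∎

  v : ℕ → ℚ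
  v j = (- 1ℚ) ^ j * q ^ j * inv (poch q q j)

  v-suc : ∀ i → (1ℚ - q ^ suc i) * v (suc i) ≡ - q * v i
  v-suc i = trans (cong (X *_) unfold) (inv-cancelˡ (- q * v i) (1-qⁱ⁺¹≢0 i))
    where
    X = 1ℚ - q ^ suc i
    regroup : ∀ s q Q P X → (- 1ℚ) * s * (q * Q) * (P * X) ≡ (- q) * (s * Q * P) * X
    regroup = solve-∀ ℚ-ring
    unfold : v (suc i) ≡ - q * v i * inv X
    unfold = trans (cong ((- 1ℚ) * (- 1ℚ) ^ i * q ^ suc i *_) (inv-* (poch q q i) X))
                   (regroup ((- 1ℚ) ^ i) q (q ^ i) (inv (poch q q i)) (inv X))

  v-step : ∀ j → v j + (- 1ℚ) * dilate v j ≡ - q * shift v j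
  v-step zero    = cancel q (v 0)
    where
    cancel : ∀ q x → x + (- 1ℚ) * (1ℚ * x) ≡ - q * 0ℚ
    cancel = solve-∀ ℚ-ring
  v-step (suc i) = trans (factor (q ^ suc i) (v (suc i))) (v-suc i)
    where
    factor : ∀ Q x → x + (- 1ℚ) * (Q * x) ≡ (1ℚ - Q) * x
    factor = solve-∀ ℚ-ring

  conv-v-suc : ∀ M → (1ℚ - q ^ suc M) * conv v (suc M) ≡ (q ^ M - q) * conv v M
  conv-v-suc M = begin
    (1ℚ - q ^ suc M) * V₁
      ≡⟨ expand (q ^ suc M) (q ^ M) V₁ V₀ ⟩
    V₁ + (- 1ℚ) * (q ^ suc M * V₁ + q ^ M * V₀) + q ^ M * V₀
      ≡⟨ cong (_+ q ^ M * V₀) convolved ⟩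
    - q * V₀ + q ^ M * V₀
      ≡⟨ collect q (q ^ M) V₀ ⟩
    (q ^ M - q) * V₀
      ∎
    where
    V₁ = conv v (suc M)
    V₀ = conv v M
    expand : ∀ Q Q′ x y → (1ℚ - Q) * x ≡ x + (- 1ℚ) * (Q * x + Q′ * y) + Q′ * y
    expand = solve-∀ ℚ-ring
    collect : ∀ q Q y → - q * y + Q * y ≡ (Q - q) * y
    collect = solve-∀ ℚ-ring
    convolved : V₁ + (- 1ℚ) * (q ^ suc M * V₁ + q ^ M * V₀) ≡ - q * V₀
    convolved = begin
      V₁ + (- 1ℚ) * (q ^ suc M * V₁ + q ^ M * V₀)  ≡⟨ cong (λ x → V₁ + (- 1ℚ) * x) (sym (conv-dilate v (suc M))) ⟩
      V₁ + (- 1ℚ) * conv (dilate v) (suc M)         ≡⟨ cong (V₁ +_) (sym (conv-* (- 1ℚ) (dilate v) (suc M))) ⟩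
      V₁ + conv (λ j → (- 1ℚ) * dilate v j) (suc M) ≡⟨ sym (conv-+ v _ (suc M)) ⟩
      conv (λ j → v j + (- 1ℚ) * dilate v j) (suc M) ≡⟨ conv-cong (suc M) v-step ⟩
      conv (λ j → - q * shift v j) (suc M)          ≡⟨ conv-* (- q) (shift v) (suc M) ⟩
      - q * conv (shift v) (suc M)                   ≡⟨ cong (- q *_) (conv-shift v (suc M)) ⟩
      - q * V₀                                       ∎

  conv-v-one : conv v 1 ≡ 1ℚ
  conv-v-one = *-cancelˡ (1-qⁱ⁺¹≢0 0) (trans (conv-v-suc 0) (same q))
    where
    same : ∀ q → (1ℚ - q) * 1ℚ ≡ (1ℚ - q * 1ℚ) * 1ℚ
    same = solve-∀ ℚ-ring

  conv-v-suc-suc : ∀ n → conv v (suc (suc n)) ≡ 0ℚ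
  conv-v-suc-suc zero    = *-cancelˡ (1-qⁱ⁺¹≢0 1) (begin
    (1ℚ - q ^ 2) * conv v 2       ≡⟨ conv-v-suc 1 ⟩
    (q ^ 1 - q) * conv v 1        ≡⟨ cong ((q ^ 1 - q) *_) conv-v-one ⟩
    (q * 1ℚ - q) * 1ℚ             ≡⟨ vanish q ⟩
    (1ℚ - q ^ 2) * 0ℚ             ∎)
    where
    vanish : ∀ q → (q * 1ℚ - q) * 1ℚ ≡ (1ℚ - q * (q * 1ℚ)) * 0ℚ
    vanish = solve-∀ ℚ-ring
  conv-v-suc-suc (suc n) = *-cancelˡ (1-qⁱ⁺¹≢0 (suc (suc n))) (begin
    (1ℚ - q ^ (3 ℕ.+ n)) * conv v (3 ℕ.+ n)   ≡⟨ conv-v-suc (2 ℕ.+ n) ⟩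
    (q ^ (2 ℕ.+ n) - q) * conv v (2 ℕ.+ n)     ≡⟨ cong ((q ^ (2 ℕ.+ n) - q) *_) (conv-v-suc-suc n) ⟩
    (q ^ (2 ℕ.+ n) - q) * 0ℚ                   ≡⟨ *-zeroʳ (q ^ (2 ℕ.+ n) - q) ⟩
    0ℚ                                          ≡⟨ sym (*-zeroʳ (1ℚ - q ^ (3 ℕ.+ n))) ⟩
    (1ℚ - q ^ (3 ℕ.+ n)) * 0ℚ                  ∎)

module Coefficients (q a b c d : ℚ)
  (1-qⁱ⁺¹≢0 : ∀ i → 1ℚ - q ^ suc i ≢ 0ℚ)
  (1-bqⁱ≢0 : ∀ i → 1ℚ - b * (q ^ i) ≢ 0ℚ)
  (1-cqⁱ≢0 : ∀ i → 1ℚ - c * (q ^ i) ≢ 0ℚ) where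

  open EulerConvolution q 1-qⁱ⁺¹≢0

  -- u_{2n} sums summand (2ℓ) (2ℓ+1) (n-ℓ) and u_{2n+1} sums summand (2ℓ+1) (2ℓ+2) (n-ℓ) over ℓ ≤ n.
  summand : ℕ → ℕ → ℕ → ℚ
  summand e f m = poch (- a * q ^ f) (q ^ 2) m * poch (- d * q ^ f) (q ^ 2) m
    * inv (poch (b * q ^ e) (q ^ 2) (suc m) * poch (c * q ^ f) (q ^ 2) m)
    * q ^ e * inv (poch q q e)

  lastSummand : ℕ → ℚ
  lastSummand e = q ^ e * inv (1ℚ - b * q ^ e) * inv (poch q q e)

  ratio : ℕ → ℚ
  ratio i = (1ℚ - (- a) * q ^ suc i) * (1ℚ - (- d) * q ^ suc i)
    * inv (1ℚ - b * q ^ suc (suc i)) * inv (1ℚ - c * q ^ suc i)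

  summand-zero : ∀ e f → summand e f 0 ≡ lastSummand e
  summand-zero e f = begin
    1ℚ * 1ℚ * inv (1ℚ * (1ℚ - b * q ^ e * 1ℚ) * 1ℚ) * q ^ e * inv (poch q q e)
      ≡⟨ cong (λ x → 1ℚ * 1ℚ * inv x * q ^ e * inv (poch q q e)) (simplify b (q ^ e)) ⟩
    1ℚ * 1ℚ * inv (1ℚ - b * q ^ e) * q ^ e * inv (poch q q e)
      ≡⟨ regroup (inv (1ℚ - b * q ^ e)) (q ^ e) (inv (poch q q e)) ⟩
    lastSummand e ∎
    where
    simplify : ∀ b Q → 1ℚ * (1ℚ - b * Q * 1ℚ) * 1ℚ ≡ 1ℚ - b * Q
    simplify = solve-∀ ℚ-ring
    regroup : ∀ x Q y → 1ℚ * 1ℚ * x * Q * y ≡ Q * x * y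
    regroup = solve-∀ ℚ-ring

  summand-suc : ∀ e f m {i} → f ℕ.+ 2 ℕ.* m ≡ suc i → e ℕ.+ 2 ℕ.* suc m ≡ suc (suc i) →
    summand e f (suc m) ≡ ratio i * summand e f m
  summand-suc e f m {i} f+2m≡1+i e+2+2m≡2+i = begin
    Pa * Fa * (Pd * Fd) * inv (Pb * Fb * (Pc * Fc)) * q ^ e * inv (poch q q e)
      ≡⟨ cong (λ x → Pa * Fa * (Pd * Fd) * x * q ^ e * inv (poch q q e)) inv-distrib ⟩
    Pa * Fa * (Pd * Fd) * (inv Pb * inv Fb * (inv Pc * inv Fc)) * q ^ e * inv (poch q q e)
      ≡⟨ regroup Pa Fa Pd Fd (inv Pb) (inv Fb) (inv Pc) (inv Fc) (q ^ e) (inv (poch q q e)) ⟩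
    Pa * Pd * (inv Pb * inv Pc) * q ^ e * inv (poch q q e) * (Fa * Fd * inv Fb * inv Fc)
      ≡⟨ cong (λ x → Pa * Pd * x * q ^ e * inv (poch q q e) * (Fa * Fd * inv Fb * inv Fc)) (sym (inv-* Pb Pc)) ⟩
    summand e f m * (Fa * Fd * inv Fb * inv Fc)
      ≡⟨ cong (summand e f m *_) factors ⟩
    summand e f m * ratio i
      ≡⟨ *-comm (summand e f m) (ratio i) ⟩
    ratio i * summand e f m ∎
    where
    p = q ^ 2
    Pa = poch (- a * q ^ f) p m
    Pd = poch (- d * q ^ f) p m
    Pb = poch (b * q ^ e) p (suc m)
    Pc = poch (c * q ^ f) p m
    Fa = 1ℚ - - a * q ^ f * p ^ m
    Fd = 1ℚ - - d * q ^ f * p ^ m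
    Fb = 1ℚ - b * q ^ e * p ^ suc m
    Fc = 1ℚ - c * q ^ f * p ^ m
    inv-distrib : inv (Pb * Fb * (Pc * Fc)) ≡ inv Pb * inv Fb * (inv Pc * inv Fc)
    inv-distrib = trans (inv-* (Pb * Fb) (Pc * Fc)) (cong₂ _*_ (inv-* Pb Fb) (inv-* Pc Fc))
    regroup : ∀ Pa Fa Pd Fd Pb Fb Pc Fc Q P →
      Pa * Fa * (Pd * Fd) * (Pb * Fb * (Pc * Fc)) * Q * P ≡ Pa * Pd * (Pb * Pc) * Q * P * (Fa * Fd * Fb * Fc)
    regroup = solve-∀ ℚ-ring
    factor : ∀ x e m {n} → e ℕ.+ 2 ℕ.* m ≡ n → 1ℚ - x * q ^ e * p ^ m ≡ 1ℚ - x * q ^ n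
    factor x e m eq = cong (λ y → 1ℚ - y) (^-geometric x q e m eq)
    factors : Fa * Fd * inv Fb * inv Fc ≡ ratio i
    factors = cong₂ _*_ (cong₂ _*_ (cong₂ _*_ (factor (- a) f m f+2m≡1+i) (factor (- d) f m f+2m≡1+i))
                                   (cong inv (factor b e (suc m) e+2+2m≡2+i)))
                        (cong inv (factor c f m f+2m≡1+i))

  summands-suc : ∀ (e f : ℕ → ℕ) n {i} →
    (∀ ℓ → ℓ ≤ n → f ℓ ℕ.+ 2 ℕ.* (n ∸ ℓ) ≡ suc i) →
    (∀ ℓ → ℓ ≤ n → e ℓ ℕ.+ 2 ℕ.* suc (n ∸ ℓ) ≡ suc (suc i)) →
    sumTo (suc n) (λ ℓ → summand (e ℓ) (f ℓ) (suc n ∸ ℓ))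
      ≡ ratio i * sumTo n (λ ℓ → summand (e ℓ) (f ℓ) (n ∸ ℓ)) + lastSummand (e (suc n))
  summands-suc e f n {i} f-exponent e-exponent = cong₂ _+_ shifted last
    where
    step : ∀ ℓ → ℓ ≤ n → summand (e ℓ) (f ℓ) (suc n ∸ ℓ) ≡ ratio i * summand (e ℓ) (f ℓ) (n ∸ ℓ)
    step ℓ ℓ≤n rewrite ℕₚ.+-∸-assoc 1 ℓ≤n =
      summand-suc (e ℓ) (f ℓ) (n ∸ ℓ) (f-exponent ℓ ℓ≤n) (e-exponent ℓ ℓ≤n)
    shifted : sumTo n (λ ℓ → summand (e ℓ) (f ℓ) (suc n ∸ ℓ))
              ≡ ratio i * sumTo n (λ ℓ → summand (e ℓ) (f ℓ) (n ∸ ℓ))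
    shifted = trans (sumTo-cong n step) (sumTo-*ˡ n (ratio i) _)
    last : summand (e (suc n)) (f (suc n)) (n ∸ n) ≡ lastSummand (e (suc n))
    last rewrite ℕₚ.n∸n≡0 n = summand-zero (e (suc n)) (f (suc n))

  uEven-suc : ∀ n {i} → 2 ℕ.* n ≡ i →
    uEven q a b c d (suc n) ≡ ratio i * uEven q a b c d n + (1ℚ - b) * lastSummand (suc (suc i))
  uEven-suc n refl = begin
    (1ℚ - b) * sumTo (suc n) (λ ℓ → summand (2 ℕ.* ℓ) (2 ℕ.* ℓ ℕ.+ 1) (suc n ∸ ℓ))
      ≡⟨ cong ((1ℚ - b) *_) (summands-suc (2 ℕ.*_) (λ ℓ → 2 ℕ.* ℓ ℕ.+ 1) n f-exponent e-exponent) ⟩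
    (1ℚ - b) * (ratio (2 ℕ.* n) * S + lastSummand (2 ℕ.* suc n))
      ≡⟨ cong (λ e → (1ℚ - b) * (ratio (2 ℕ.* n) * S + lastSummand e)) (ℕₚ.*-suc 2 n) ⟩
    (1ℚ - b) * (ratio (2 ℕ.* n) * S + lastSummand (suc (suc (2 ℕ.* n))))
      ≡⟨ distrib (1ℚ - b) (ratio (2 ℕ.* n)) S _ ⟩
    ratio (2 ℕ.* n) * ((1ℚ - b) * S) + (1ℚ - b) * lastSummand (suc (suc (2 ℕ.* n))) ∎
    where
    S = sumTo n (λ ℓ → summand (2 ℕ.* ℓ) (2 ℕ.* ℓ ℕ.+ 1) (n ∸ ℓ))
    distrib : ∀ x r S L → x * (r * S + L) ≡ r * (x * S) + x * L
    distrib = solve-∀ ℚ-ring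
    f-shape : ∀ x y → (2 ℕ.* x ℕ.+ 1) ℕ.+ 2 ℕ.* y ≡ suc (2 ℕ.* x ℕ.+ 2 ℕ.* y)
    f-shape = ℕ-Solver.solve-∀
    e-shape : ∀ x y → 2 ℕ.* x ℕ.+ 2 ℕ.* suc y ≡ suc (suc (2 ℕ.* x ℕ.+ 2 ℕ.* y))
    e-shape = ℕ-Solver.solve-∀
    f-exponent : ∀ ℓ → ℓ ≤ n → (2 ℕ.* ℓ ℕ.+ 1) ℕ.+ 2 ℕ.* (n ∸ ℓ) ≡ suc (2 ℕ.* n)
    f-exponent ℓ ℓ≤n = trans (f-shape ℓ (n ∸ ℓ)) (cong suc (twice-split ℓ≤n))
    e-exponent : ∀ ℓ → ℓ ≤ n → 2 ℕ.* ℓ ℕ.+ 2 ℕ.* suc (n ∸ ℓ) ≡ suc (suc (2 ℕ.* n))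
    e-exponent ℓ ℓ≤n = trans (e-shape ℓ (n ∸ ℓ)) (cong (λ k → suc (suc k)) (twice-split ℓ≤n))

  uOdd-suc : ∀ n {i} → suc (2 ℕ.* n) ≡ i →
    uOdd q a b c d (suc n) ≡ ratio i * uOdd q a b c d n + (b - 1ℚ) * lastSummand (suc (suc i))
  uOdd-suc n refl = begin
    (b - 1ℚ) * sumTo (suc n) (λ ℓ → summand (2 ℕ.* ℓ ℕ.+ 1) (2 ℕ.* ℓ ℕ.+ 2) (suc n ∸ ℓ))
      ≡⟨ cong ((b - 1ℚ) *_)
              (summands-suc (λ ℓ → 2 ℕ.* ℓ ℕ.+ 1) (λ ℓ → 2 ℕ.* ℓ ℕ.+ 2) n f-exponent e-exponent) ⟩
    (b - 1ℚ) * (ratio (suc (2 ℕ.* n)) * S + lastSummand (2 ℕ.* suc n ℕ.+ 1))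
      ≡⟨ cong (λ e → (b - 1ℚ) * (ratio (suc (2 ℕ.* n)) * S + lastSummand e)) (last-shape n) ⟩
    (b - 1ℚ) * (ratio (suc (2 ℕ.* n)) * S + lastSummand (suc (suc (suc (2 ℕ.* n)))))
      ≡⟨ distrib (b - 1ℚ) (ratio (suc (2 ℕ.* n))) S _ ⟩
    ratio (suc (2 ℕ.* n)) * ((b - 1ℚ) * S) + (b - 1ℚ) * lastSummand (suc (suc (suc (2 ℕ.* n)))) ∎
    where
    S = sumTo n (λ ℓ → summand (2 ℕ.* ℓ ℕ.+ 1) (2 ℕ.* ℓ ℕ.+ 2) (n ∸ ℓ))
    distrib : ∀ x r S L → x * (r * S + L) ≡ r * (x * S) + x * L
    distrib = solve-∀ ℚ-ring
    last-shape : ∀ n → 2 ℕ.* suc n ℕ.+ 1 ≡ suc (suc (suc (2 ℕ.* n)))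
    last-shape = ℕ-Solver.solve-∀
    f-shape : ∀ x y → (2 ℕ.* x ℕ.+ 2) ℕ.+ 2 ℕ.* y ≡ suc (suc (2 ℕ.* x ℕ.+ 2 ℕ.* y))
    f-shape = ℕ-Solver.solve-∀
    e-shape : ∀ x y → (2 ℕ.* x ℕ.+ 1) ℕ.+ 2 ℕ.* suc y ≡ suc (suc (suc (2 ℕ.* x ℕ.+ 2 ℕ.* y)))
    e-shape = ℕ-Solver.solve-∀
    f-exponent : ∀ ℓ → ℓ ≤ n → (2 ℕ.* ℓ ℕ.+ 2) ℕ.+ 2 ℕ.* (n ∸ ℓ) ≡ suc (suc (2 ℕ.* n))
    f-exponent ℓ ℓ≤n = trans (f-shape ℓ (n ∸ ℓ)) (cong (λ k → suc (suc k)) (twice-split ℓ≤n))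
    e-exponent : ∀ ℓ → ℓ ≤ n → (2 ℕ.* ℓ ℕ.+ 1) ℕ.+ 2 ℕ.* suc (n ∸ ℓ) ≡ suc (suc (suc (2 ℕ.* n)))
    e-exponent ℓ ℓ≤n = trans (e-shape ℓ (n ∸ ℓ)) (cong (λ k → suc (suc (suc k))) (twice-split ℓ≤n))

  u′ : ℕ → ℚ
  u′ = u q a b c d

  u-even : ∀ j → isEven j ≡ true → u′ j ≡ uEven q a b c d ⌊ j /2⌋
  u-even j even = cong (λ t → if t then uEven q a b c d ⌊ j /2⌋ else uOdd q a b c d ⌊ j /2⌋) even

  u-odd : ∀ j → isEven j ≡ false → u′ j ≡ uOdd q a b c d ⌊ j /2⌋
  u-odd j odd = cong (λ t → if t then uEven q a b c d ⌊ j /2⌋ else uOdd q a b c d ⌊ j /2⌋) odd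

  u-suc-suc : ∀ i → u′ (suc (suc i)) ≡ ratio i * u′ i + (1ℚ - b) * (- 1ℚ) ^ i * lastSummand (suc (suc i))
  u-suc-suc i = by-parity (isEven i) refl
    where
    L = lastSummand (suc (suc i))
    goal = u′ (suc (suc i)) ≡ ratio i * u′ i + (1ℚ - b) * (- 1ℚ) ^ i * L
    even-sign : ∀ x L → x * L ≡ x * 1ℚ * L
    even-sign = solve-∀ ℚ-ring
    odd-sign : ∀ b L → (b - 1ℚ) * L ≡ (1ℚ - b) * - 1ℚ * L
    odd-sign = solve-∀ ℚ-ring
    by-parity : ∀ (p : Bool) → isEven i ≡ p → goal
    by-parity true parity = begin
      u′ (suc (suc i))
        ≡⟨ u-even (suc (suc i)) (trans (isEven-suc-suc i) parity) ⟩
      uEven q a b c d (suc ⌊ i /2⌋)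
        ≡⟨ uEven-suc ⌊ i /2⌋ (even-half i parity) ⟩
      ratio i * uEven q a b c d ⌊ i /2⌋ + (1ℚ - b) * L
        ≡⟨ cong (ratio i * uEven q a b c d ⌊ i /2⌋ +_) (even-sign (1ℚ - b) L) ⟩
      ratio i * uEven q a b c d ⌊ i /2⌋ + (1ℚ - b) * 1ℚ * L
        ≡⟨ cong₂ (λ x s → ratio i * x + (1ℚ - b) * s * L) (sym (u-even i parity)) (sym (sign-even i parity)) ⟩
      ratio i * u′ i + (1ℚ - b) * (- 1ℚ) ^ i * L ∎
    by-parity false parity = begin
      u′ (suc (suc i))
        ≡⟨ u-odd (suc (suc i)) (trans (isEven-suc-suc i) parity) ⟩
      uOdd q a b c d (suc ⌊ i /2⌋)
        ≡⟨ uOdd-suc ⌊ i /2⌋ (odd-half i parity) ⟩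
      ratio i * uOdd q a b c d ⌊ i /2⌋ + (b - 1ℚ) * L
        ≡⟨ cong (ratio i * uOdd q a b c d ⌊ i /2⌋ +_) (odd-sign b L) ⟩
      ratio i * uOdd q a b c d ⌊ i /2⌋ + (1ℚ - b) * - 1ℚ * L
        ≡⟨ cong₂ (λ x s → ratio i * x + (1ℚ - b) * s * L) (sym (u-odd i parity)) (sym (sign-odd i parity)) ⟩
      ratio i * u′ i + (1ℚ - b) * (- 1ℚ) ^ i * L ∎

  u-recurrence : ∀ i →
    (1ℚ - b * q ^ suc (suc i)) * (1ℚ - c * q ^ suc i) * u′ (suc (suc i))
      ≡ (1ℚ - (- a) * q ^ suc i) * (1ℚ - (- d) * q ^ suc i) * u′ i
        + (1ℚ - b) * (1ℚ - c * q ^ suc i) * v (suc (suc i))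
  u-recurrence i = begin
    Fb * Fc * u′ (suc (suc i))
      ≡⟨ cong (λ x → Fb * Fc * x) (u-suc-suc i) ⟩
    Fb * Fc * (Fa * inv Fb * inv Fc * u′ i + (1ℚ - b) * σ * (Q * inv Fb * inv P))
      ≡⟨ regroup Fb Fc Fa (inv Fb) (inv Fc) (u′ i) (1ℚ - b) σ Q (inv P) ⟩
    Fb * inv Fb * (Fc * inv Fc * (Fa * u′ i) + (1ℚ - b) * Fc * σ * Q * inv P)
      ≡⟨ cong₂ (λ x y → x * (y * (Fa * u′ i) + (1ℚ - b) * Fc * σ * Q * inv P))
               (inv-inverseʳ (1-bqⁱ≢0 (suc (suc i)))) (inv-inverseʳ (1-cqⁱ≢0 (suc i))) ⟩
    1ℚ * (1ℚ * (Fa * u′ i) + (1ℚ - b) * Fc * σ * Q * inv P)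
      ≡⟨ simplify Fa (u′ i) (1ℚ - b) Fc σ Q (inv P) ⟩
    Fa * u′ i + (1ℚ - b) * Fc * v (suc (suc i)) ∎
    where
    Fa = (1ℚ - (- a) * q ^ suc i) * (1ℚ - (- d) * q ^ suc i)
    Fb = 1ℚ - b * q ^ suc (suc i)
    Fc = 1ℚ - c * q ^ suc i
    σ = (- 1ℚ) ^ i
    Q = q ^ suc (suc i)
    P = poch q q (suc (suc i))
    regroup : ∀ Fb Fc Fa iB iC x k σ Q iP →
      Fb * Fc * (Fa * iB * iC * x + k * σ * (Q * iB * iP)) ≡ Fb * iB * (Fc * iC * (Fa * x) + k * Fc * σ * Q * iP)
    regroup = solve-∀ ℚ-ring
    simplify : ∀ Fa x k Fc σ Q iP →
      1ℚ * (1ℚ * (Fa * x) + k * Fc * σ * Q * iP) ≡ Fa * x + k * Fc * ((- 1ℚ) * ((- 1ℚ) * σ) * Q * iP)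
    simplify = solve-∀ ℚ-ring

  u-zero : u′ 0 ≡ 1ℚ
  u-zero = begin
    (1ℚ - b) * summand 0 1 0                          ≡⟨ cong ((1ℚ - b) *_) (summand-zero 0 1) ⟩
    (1ℚ - b) * (1ℚ * inv (1ℚ - b * 1ℚ) * 1ℚ)          ≡⟨ simplify b (inv (1ℚ - b * 1ℚ)) ⟩
    (1ℚ - b * 1ℚ) * inv (1ℚ - b * 1ℚ)                 ≡⟨ inv-inverseʳ (1-bqⁱ≢0 0) ⟩
    1ℚ                                                ∎
    where
    simplify : ∀ b x → (1ℚ - b) * (1ℚ * x * 1ℚ) ≡ (1ℚ - b * 1ℚ) * x
    simplify = solve-∀ ℚ-ring

  u-one : (1ℚ - b * q ^ 1) * u′ 1 ≡ (1ℚ - b) * v 1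
  u-one = begin
    Fb * ((b - 1ℚ) * summand 1 2 0)                   ≡⟨ cong (λ x → Fb * ((b - 1ℚ) * x)) (summand-zero 1 2) ⟩
    Fb * ((b - 1ℚ) * (q ^ 1 * inv Fb * iP))           ≡⟨ regroup Fb (inv Fb) b (q ^ 1) iP ⟩
    Fb * inv Fb * ((b - 1ℚ) * q ^ 1 * iP)             ≡⟨ cong (_* ((b - 1ℚ) * q ^ 1 * iP)) (inv-inverseʳ (1-bqⁱ≢0 1)) ⟩
    1ℚ * ((b - 1ℚ) * q ^ 1 * iP)                      ≡⟨ sign b (q ^ 1) iP ⟩
    (1ℚ - b) * v 1                                    ∎
    where
    Fb = 1ℚ - b * q ^ 1
    iP = inv (poch q q 1)
    regroup : ∀ B iB b Q iP → B * ((b - 1ℚ) * (Q * iB * iP)) ≡ B * iB * ((b - 1ℚ) * Q * iP)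
    regroup = solve-∀ ℚ-ring
    sign : ∀ b Q iP → 1ℚ * ((b - 1ℚ) * Q * iP) ≡ (1ℚ - b) * ((- 1ℚ) * 1ℚ * Q * iP)
    sign = solve-∀ ℚ-ring

  u-relation-initial : ∀ j → (1ℚ - b * q ^ j) * u′ j ≡ (1ℚ - b) * v j →
    dilatePoly q (- (c + b * q)) (b * c) u′ j ≡ dilatePoly ((1ℚ - b) * q) (- ((1ℚ - b) * c)) 0ℚ v j + 0ℚ
  u-relation-initial j base = begin
    q * u′ j + - (c + b * q) * (Q * u′ j) + b * c * (Q * (Q * u′ j))  ≡⟨ factor q Q b c (u′ j) ⟩
    (q - c * Q) * ((1ℚ - b * Q) * u′ j)                                ≡⟨ cong ((q - c * Q) *_) base ⟩
    (q - c * Q) * ((1ℚ - b) * v j)                                     ≡⟨ expand q Q b c (v j) ⟩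
    (1ℚ - b) * q * v j + - ((1ℚ - b) * c) * (Q * v j) + 0ℚ * (Q * (Q * v j)) + 0ℚ ∎
    where
    Q = q ^ j
    factor : ∀ q Q b c U → q * U + - (c + b * q) * (Q * U) + b * c * (Q * (Q * U)) ≡ (q - c * Q) * ((1ℚ - b * Q) * U)
    factor = solve-∀ ℚ-ring
    expand : ∀ q Q b c V →
      (q - c * Q) * ((1ℚ - b) * V) ≡ (1ℚ - b) * q * V + - ((1ℚ - b) * c) * (Q * V) + 0ℚ * (Q * (Q * V)) + 0ℚ
    expand = solve-∀ ℚ-ring

  u-relation : ∀ j →
    dilatePoly q (- (c + b * q)) (b * c) u′ j
      ≡ dilatePoly ((1ℚ - b) * q) (- ((1ℚ - b) * c)) 0ℚ v j
        + shift (shift (dilatePoly q ((a + d) * q * q) (a * d * q * q * q) u′)) j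
  u-relation zero          = u-relation-initial 0 (trans (cong ((1ℚ - b * 1ℚ) *_) u-zero) (same b))
    where
    same : ∀ b → (1ℚ - b * 1ℚ) * 1ℚ ≡ (1ℚ - b) * 1ℚ
    same = solve-∀ ℚ-ring
  u-relation (suc zero)    = u-relation-initial 1 u-one
  u-relation (suc (suc i)) = begin
    q * U₂ + - (c + b * q) * (q ^ suc (suc i) * U₂) + b * c * (q ^ suc (suc i) * (q ^ suc (suc i) * U₂))
      ≡⟨ factor q (q ^ i) b c U₂ ⟩
    q * ((1ℚ - b * q ^ suc (suc i)) * (1ℚ - c * q ^ suc i) * U₂)
      ≡⟨ cong (q *_) (u-recurrence i) ⟩
    q * ((1ℚ - (- a) * q ^ suc i) * (1ℚ - (- d) * q ^ suc i) * u′ i + (1ℚ - b) * (1ℚ - c * q ^ suc i) * V₂)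
      ≡⟨ expand q (q ^ i) a b c d (u′ i) V₂ ⟩
    _ ∎
    where
    U₂ = u′ (suc (suc i))
    V₂ = v (suc (suc i))
    factor : ∀ q P b c U →
      q * U + - (c + b * q) * (q * (q * P) * U) + b * c * (q * (q * P) * (q * (q * P) * U))
        ≡ q * ((1ℚ - b * (q * (q * P))) * (1ℚ - c * (q * P)) * U)
    factor = solve-∀ ℚ-ring
    expand : ∀ q P a b c d U V →
      q * ((1ℚ - (- a) * (q * P)) * (1ℚ - (- d) * (q * P)) * U + (1ℚ - b) * (1ℚ - c * (q * P)) * V)
        ≡ (1ℚ - b) * q * V + - ((1ℚ - b) * c) * (q * (q * P) * V) + 0ℚ * (q * (q * P) * (q * (q * P) * V))
          + (q * U + (a + d) * q * q * (P * U) + a * d * q * q * q * (P * (P * U)))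
    expand = solve-∀ ℚ-ring

module Recurrence (q a b c d : ℚ) (q≢0 : q ≢ 0ℚ) (a≢0 : a ≢ 0ℚ) (d≢0 : d ≢ 0ℚ)
  (1-qⁱ⁺¹≢0 : ∀ i → 1ℚ - q ^ suc i ≢ 0ℚ)
  (1-bqⁱ≢0 : ∀ i → 1ℚ - b * (q ^ i) ≢ 0ℚ)
  (1-cqⁱ≢0 : ∀ i → 1ℚ - c * (q ^ i) ≢ 0ℚ) where

  open EulerConvolution q 1-qⁱ⁺¹≢0
  open Coefficients q a b c d 1-qⁱ⁺¹≢0 1-bqⁱ≢0 1-cqⁱ≢0 using (u′; u-zero; u-one; u-relation)

  s : ℕ → ℚ
  s = conv u′

  -- q times the defect of the recurrence of H_{n-1} when evaluated on s, with s_{-1} = s_{-2} = 0.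
  defect : ℕ → ℚ
  defect n = q * s n - (c + b * q) * dilate s n + b * c * dilate (dilate s) n
    - q * shift s n + b * c * q * shift (dilate (dilate s)) n
    - (a + d) * q * q * shift (shift (dilate s)) n
    - a * d * q * q * q * shift (shift (dilate (dilate s))) n
    - a * d * q * q * q * q * shift (shift (shift (dilate (dilate s)))) n

  inhomogeneity : ℕ → ℚ
  inhomogeneity = conv (dilatePoly ((1ℚ - b) * q) (- ((1ℚ - b) * c)) 0ℚ v)

  defect-telescopes : ∀ M → defect (suc (suc M)) + defect (suc M) ≡ inhomogeneity (suc (suc M))
  defect-telescopes M = begin
    defect (suc (suc M)) + defect (suc M)
      ≡⟨ telescope q (q ^ M) a b c d (s (suc (suc M))) (s (suc M)) (s M) A B C ⟩
    _ ≡⟨ sym (cong₂ _-_ (conv-dilatePoly q (- (c + b * q)) (b * c) u′ (suc (suc M)))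
                        (conv-dilatePoly q ((a + d) * q * q) (a * d * q * q * q) u′ M)) ⟩
    conv L (suc (suc M)) - conv Z M
      ≡⟨ cong (_- conv Z M) convolved ⟩
    inhomogeneity (suc (suc M)) + conv Z M - conv Z M
      ≡⟨ cancel (inhomogeneity (suc (suc M))) (conv Z M) ⟩
    inhomogeneity (suc (suc M)) ∎
    where
    L = dilatePoly q (- (c + b * q)) (b * c) u′
    V = dilatePoly ((1ℚ - b) * q) (- ((1ℚ - b) * c)) 0ℚ v
    Z = dilatePoly q ((a + d) * q * q) (a * d * q * q * q) u′
    A = shift (dilate s) M
    B = shift (dilate (dilate s)) M
    C = shift (shift (dilate (dilate s))) M
    convolved : conv L (suc (suc M)) ≡ inhomogeneity (suc (suc M)) + conv Z M
    convolved = begin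
      conv L (suc (suc M))
        ≡⟨ conv-cong (suc (suc M)) u-relation ⟩
      conv (λ j → V j + shift (shift Z) j) (suc (suc M))
        ≡⟨ conv-+ V (shift (shift Z)) (suc (suc M)) ⟩
      inhomogeneity (suc (suc M)) + conv (shift (shift Z)) (suc (suc M))
        ≡⟨ cong (inhomogeneity (suc (suc M)) +_) (trans (conv-shift (shift Z) (suc (suc M))) (conv-shift Z (suc M))) ⟩
      inhomogeneity (suc (suc M)) + conv Z M ∎
    cancel : ∀ x y → x + y - y ≡ x
    cancel = solve-∀ ℚ-ring
    telescope : ∀ q P a b c d s₂ s₁ s₀ A B C →
      q * s₂ - (c + b * q) * (q * (q * P) * s₂) + b * c * (q * (q * P) * (q * (q * P) * s₂))
        - q * s₁ + b * c * q * (q * P * (q * P * s₁)) - (a + d) * q * q * (P * s₀)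
        - a * d * q * q * q * (P * (P * s₀)) - a * d * q * q * q * q * B
      + (q * s₁ - (c + b * q) * (q * P * s₁) + b * c * (q * P * (q * P * s₁))
        - q * s₀ + b * c * q * (P * (P * s₀)) - (a + d) * q * q * A
        - a * d * q * q * q * B - a * d * q * q * q * q * C)
      ≡ q * s₂ + - (c + b * q) * (q * (q * P) * s₂ + q * P * s₁)
          + b * c * (q * (q * P) * (q * (q * P) * s₂) + (1ℚ + q) * (q * P * (q * P * s₁)) + q * (P * (P * s₀)))
        - (q * s₀ + (a + d) * q * q * (P * s₀ + A)
          + a * d * q * q * q * (P * (P * s₀) + (1ℚ + q) * B + q * C))
    telescope = solve-∀ ℚ-ring

  inhomogeneity-conv-v : ∀ n →
    inhomogeneity n ≡ (1ℚ - b) * (q * conv v n - c * (dilate (conv v) n + shift (dilate (conv v)) n))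
  inhomogeneity-conv-v n =
    trans (conv-dilatePoly ((1ℚ - b) * q) (- ((1ℚ - b) * c)) 0ℚ v n)
          (collect q b c (conv v n) (dilate (conv v) n) (shift (dilate (conv v)) n) W)
    where
    DDV = dilate (dilate (conv v))
    W = DDV n + (1ℚ + q) * shift DDV n + q * shift (shift DDV) n
    collect : ∀ q b c V D S W →
      (1ℚ - b) * q * V + - ((1ℚ - b) * c) * (D + S) + 0ℚ * W ≡ (1ℚ - b) * (q * V - c * (D + S))
    collect = solve-∀ ℚ-ring

  inhomogeneity-two : inhomogeneity 2 ≡ - ((1ℚ - b) * c * q)
  inhomogeneity-two = begin
    inhomogeneity 2
      ≡⟨ inhomogeneity-conv-v 2 ⟩
    (1ℚ - b) * (q * conv v 2 - c * (q ^ 2 * conv v 2 + q ^ 1 * conv v 1))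
      ≡⟨ cong₂ (λ x y → (1ℚ - b) * (q * x - c * (q ^ 2 * x + q ^ 1 * y))) (conv-v-suc-suc 0) conv-v-one ⟩
    (1ℚ - b) * (q * 0ℚ - c * (q ^ 2 * 0ℚ + q * 1ℚ * 1ℚ))
      ≡⟨ evaluate q b c (q ^ 2) ⟩
    - ((1ℚ - b) * c * q) ∎
    where
    evaluate : ∀ q b c Q → (1ℚ - b) * (q * 0ℚ - c * (Q * 0ℚ + q * 1ℚ * 1ℚ)) ≡ - ((1ℚ - b) * c * q)
    evaluate = solve-∀ ℚ-ring

  inhomogeneity-vanishes : ∀ n → inhomogeneity (3 ℕ.+ n) ≡ 0ℚ
  inhomogeneity-vanishes n = begin
    inhomogeneity (3 ℕ.+ n)
      ≡⟨ inhomogeneity-conv-v (3 ℕ.+ n) ⟩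
    (1ℚ - b) * (q * conv v (3 ℕ.+ n) - c * (q ^ (3 ℕ.+ n) * conv v (3 ℕ.+ n) + q ^ (2 ℕ.+ n) * conv v (2 ℕ.+ n)))
      ≡⟨ cong₂ (λ x y → (1ℚ - b) * (q * x - c * (q ^ (3 ℕ.+ n) * x + q ^ (2 ℕ.+ n) * y)))
               (conv-v-suc-suc (suc n)) (conv-v-suc-suc n) ⟩
    (1ℚ - b) * (q * 0ℚ - c * (q ^ (3 ℕ.+ n) * 0ℚ + q ^ (2 ℕ.+ n) * 0ℚ))
      ≡⟨ evaluate q b c (q ^ (3 ℕ.+ n)) (q ^ (2 ℕ.+ n)) ⟩
    0ℚ ∎
    where
    evaluate : ∀ q b c Q Q′ → (1ℚ - b) * (q * 0ℚ - c * (Q * 0ℚ + Q′ * 0ℚ)) ≡ 0ℚ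
    evaluate = solve-∀ ℚ-ring

  s-zero : s 0 ≡ 1ℚ
  s-zero = cong (_* euler 0) u-zero

  s-one : (1ℚ - b * q ^ 1) * s 1 ≡ 1ℚ
  s-one = begin
    Fb * (u′ 0 * euler 1 + u′ 1 * euler 0)         ≡⟨ distrib Fb (u′ 0) (euler 1) (u′ 1) (euler 0) ⟩
    Fb * u′ 0 * euler 1 + Fb * u′ 1 * euler 0      ≡⟨ cong₂ (λ x y → Fb * x * euler 1 + y * euler 0) u-zero u-one ⟩
    Fb * 1ℚ * (1ℚ * iP) + (1ℚ - b) * v 1 * 1ℚ      ≡⟨ collect q b iP ⟩
    P * iP                                         ≡⟨ inv-inverseʳ P≢0 ⟩
    1ℚ                                             ∎
    where
    Fb = 1ℚ - b * q ^ 1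
    P = poch q q 1
    iP = inv P
    P≢0 : P ≢ 0ℚ
    P≢0 P≡0 = 1-qⁱ⁺¹≢0 0 (trans (sym (*-identityˡ _)) P≡0)
    distrib : ∀ F x e y e′ → F * (x * e + y * e′) ≡ F * x * e + F * y * e′
    distrib = solve-∀ ℚ-ring
    collect : ∀ q b iP → (1ℚ - b * (q * 1ℚ)) * 1ℚ * (1ℚ * iP) + (1ℚ - b) * ((- 1ℚ) * 1ℚ * (q * 1ℚ) * iP) * 1ℚ
                         ≡ 1ℚ * (1ℚ - q * 1ℚ) * iP
    collect = solve-∀ ℚ-ring

  defect-one : defect 1 ≡ - ((1ℚ - b) * c * q)
  defect-one = begin
    defect 1
      ≡⟨ factor q a b c d (s 1) (s 0) ⟩
    (q - c * (q * 1ℚ)) * ((1ℚ - b * q ^ 1) * s 1) + (b * c * q - q) * s 0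
      ≡⟨ cong₂ (λ x y → (q - c * (q * 1ℚ)) * x + (b * c * q - q) * y) s-one s-zero ⟩
    (q - c * (q * 1ℚ)) * 1ℚ + (b * c * q - q) * 1ℚ
      ≡⟨ evaluate q b c ⟩
    - ((1ℚ - b) * c * q) ∎
    where
    factor : ∀ q a b c d s₁ s₀ →
      q * s₁ - (c + b * q) * (q * 1ℚ * s₁) + b * c * (q * 1ℚ * (q * 1ℚ * s₁))
        - q * s₀ + b * c * q * (1ℚ * (1ℚ * s₀)) - (a + d) * q * q * 0ℚ
        - a * d * q * q * q * 0ℚ - a * d * q * q * q * q * 0ℚ
      ≡ (q - c * (q * 1ℚ)) * ((1ℚ - b * (q * 1ℚ)) * s₁) + (b * c * q - q) * s₀
    factor = solve-∀ ℚ-ring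
    evaluate : ∀ q b c → (q - c * (q * 1ℚ)) * 1ℚ + (b * c * q - q) * 1ℚ ≡ - ((1ℚ - b) * c * q)
    evaluate = solve-∀ ℚ-ring

  defect-vanishes : ∀ n → defect (suc (suc n)) ≡ 0ℚ
  defect-vanishes zero    = begin
    defect 2                                      ≡⟨ x+y≡z⇒x≡z-y (defect-telescopes 0) ⟩
    inhomogeneity 2 - defect 1                    ≡⟨ cong₂ _-_ inhomogeneity-two defect-one ⟩
    - ((1ℚ - b) * c * q) - - ((1ℚ - b) * c * q)   ≡⟨ x-x≡0 (- ((1ℚ - b) * c * q)) ⟩
    0ℚ                                            ∎
    where
    x-x≡0 : ∀ x → x - x ≡ 0ℚ
    x-x≡0 = solve-∀ ℚ-ring
  defect-vanishes (suc n) = begin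
    defect (3 ℕ.+ n)                              ≡⟨ x+y≡z⇒x≡z-y (defect-telescopes (suc n)) ⟩
    inhomogeneity (3 ℕ.+ n) - defect (2 ℕ.+ n)    ≡⟨ cong₂ _-_ (inhomogeneity-vanishes n) (defect-vanishes n) ⟩
    0ℚ - 0ℚ                                       ≡⟨⟩
    0ℚ                                            ∎

  recurrenceCoefficient : ℕ → ℚ
  recurrenceCoefficient k = (1ℚ - c * (q ^ k)) * (1ℚ - b * (q ^ suc k))

  recurrenceCombination : ℕ → ℚ → ℚ → ℚ → ℚ
  recurrenceCombination k x y z =
    (1ℚ - b * c * (q ^ (2 ℕ.* k))) * x + (a * (q ^ k) + d * (q ^ k) + a * d * (q ^ (2 ℕ.* k))) * y
    + a * d * q2k-1 q k * z

  q³*shift-dilate² : ∀ f k → q * q * q * shift (dilate (dilate f)) k ≡ q2k-1 q (suc k) * shift f k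
  q³*shift-dilate² f zero    = vanish q (q ^ 1)
    where
    vanish : ∀ q Q → q * q * q * 0ℚ ≡ Q * 0ℚ
    vanish = solve-∀ ℚ-ring
  q³*shift-dilate² f (suc k) = begin
    q * q * q * (q ^ k * (q ^ k * f k))        ≡⟨ regroup q (q ^ k) (f k) ⟩
    q * (q * q ^ k * (q * q ^ k)) * f k        ≡⟨ cong (λ x → q * x * f k) (sym (^-double q (suc k))) ⟩
    q ^ suc (2 ℕ.* suc k) * f k                ∎
    where
    regroup : ∀ q P x → q * q * q * (P * (P * x)) ≡ q * (q * P * (q * P)) * x
    regroup = solve-∀ ℚ-ring

  s-recurrence : ∀ k →
    recurrenceCoefficient (suc k) * s (suc (suc k)) ≡ recurrenceCombination (suc k) (s (suc k)) (s k) (shift s k)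
  s-recurrence k = begin
    L * s (suc (suc k))                          ≡⟨ isolate (L * s (suc (suc k))) R ⟩
    (L * s (suc (suc k)) - R) + R               ≡⟨ cong (_+ R) (*-cancelˡ q≢0 (trans scaled (sym (*-zeroʳ q)))) ⟩
    0ℚ + R                                      ≡⟨ +-identityˡ R ⟩
    R                                           ∎
    where
    L = recurrenceCoefficient (suc k)
    R = recurrenceCombination (suc k) (s (suc k)) (s k) (shift s k)
    P = q ^ k
    B = shift (dilate (dilate s)) k
    isolate : ∀ x y → x ≡ (x - y) + y
    isolate = solve-∀ ℚ-ring
    combination : R ≡ (1ℚ - b * c * (q * P * (q * P))) * s (suc k)
                      + (a * (q * P) + d * (q * P) + a * d * (q * P * (q * P))) * s k + a * d * (q * q * q * B)
    combination = cong₂ (λ Q² w → (1ℚ - b * c * Q²) * s (suc k) + (a * (q * P) + d * (q * P) + a * d * Q²) * s k + w)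
                        (^-double q (suc k))
                        (trans (*-assoc (a * d) _ (shift s k)) (cong (a * d *_) (sym (q³*shift-dilate² s k))))
    expand : ∀ q P a b c d s₂ s₁ s₀ B →
      q * ((1ℚ - c * (q * P)) * (1ℚ - b * (q * (q * P))) * s₂
           - ((1ℚ - b * c * (q * P * (q * P))) * s₁ + (a * (q * P) + d * (q * P) + a * d * (q * P * (q * P))) * s₀
              + a * d * (q * q * q * B)))
      ≡ q * s₂ - (c + b * q) * (q * (q * P) * s₂) + b * c * (q * (q * P) * (q * (q * P) * s₂))
        - q * s₁ + b * c * q * (q * P * (q * P * s₁)) - (a + d) * q * q * (P * s₀)
        - a * d * q * q * q * (P * (P * s₀)) - a * d * q * q * q * q * B
    expand = solve-∀ ℚ-ring
    scaled : q * (L * s (suc (suc k)) - R) ≡ 0ℚ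
    scaled = begin
      q * (L * s (suc (suc k)) - R)   ≡⟨ cong (λ x → q * (L * s (suc (suc k)) - x)) combination ⟩
      _                               ≡⟨ expand q P a b c d (s (suc (suc k))) (s (suc k)) (s k) B ⟩
      defect (suc (suc k))            ≡⟨ defect-vanishes k ⟩
      0ℚ                              ∎

  H₀≡s₁ : Hsh q a b c d 3 ≡ s 1
  H₀≡s₁ = begin
    inv (C₀ * B₁) * combination              ≡⟨ cong (inv (C₀ * B₁) *_) combination≡C₀ ⟩
    inv (C₀ * B₁) * C₀                       ≡⟨ cong (_* C₀) (inv-* C₀ B₁) ⟩
    inv C₀ * inv B₁ * C₀                     ≡⟨ regroup (inv C₀) (inv B₁) C₀ ⟩
    C₀ * (inv B₁ * inv C₀)                   ≡⟨ inv-cancelˡ (inv B₁) (1-cqⁱ≢0 0) ⟩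
    inv B₁                                   ≡⟨ sym (*-identityʳ (inv B₁)) ⟩
    inv B₁ * 1ℚ                              ≡⟨ sym (*-solveˡ (1-bqⁱ≢0 1) s-one) ⟩
    s 1                                      ∎
    where
    C₀ = 1ℚ - c * 1ℚ
    B₁ = 1ℚ - b * q ^ 1
    combination = recurrenceCombination 0 1ℚ 0ℚ ((b - 1ℚ) * c * q * inv (a * d))
    regroup : ∀ x y z → x * y * z ≡ z * (y * x)
    regroup = solve-∀ ℚ-ring
    expand : ∀ a b c d q q⁻¹ ad⁻¹ →
      (1ℚ - b * c * 1ℚ) * 1ℚ + (a * 1ℚ + d * 1ℚ + a * d * 1ℚ) * 0ℚ + a * d * q⁻¹ * ((b - 1ℚ) * c * q * ad⁻¹)
        ≡ 1ℚ - c * 1ℚ + (b - 1ℚ) * c * (a * d * ad⁻¹ * (q * q⁻¹) - 1ℚ)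
    expand = solve-∀ ℚ-ring
    combination≡C₀ : combination ≡ C₀
    combination≡C₀ = begin
      combination                                                     ≡⟨ expand a b c d q (inv q) (inv (a * d)) ⟩
      C₀ + (b - 1ℚ) * c * (a * d * inv (a * d) * (q * inv q) - 1ℚ)
        ≡⟨ cong₂ (λ x y → C₀ + (b - 1ℚ) * c * (x * y - 1ℚ)) (inv-inverseʳ (*-≢0 a≢0 d≢0)) (inv-inverseʳ q≢0) ⟩
      C₀ + (b - 1ℚ) * c * (1ℚ * 1ℚ - 1ℚ)                              ≡⟨ vanish C₀ ((b - 1ℚ) * c) ⟩
      C₀                                                              ∎
      where
      vanish : ∀ x y → x + y * (1ℚ * 1ℚ - 1ℚ) ≡ x
      vanish = solve-∀ ℚ-ring

  Hsh≡shift-s : ∀ n → Hsh q a b c d (suc n) ≡ shift s n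
  Hsh≡shift-s zero                = refl
  Hsh≡shift-s (suc zero)          = sym s-zero
  Hsh≡shift-s (suc (suc zero))    = H₀≡s₁
  Hsh≡shift-s (suc (suc (suc k))) = begin
    inv L * recurrenceCombination (suc k) (Hsh q a b c d (3 ℕ.+ k)) (Hsh q a b c d (2 ℕ.+ k)) (Hsh q a b c d (suc k))
      ≡⟨ cong₂ (λ x y → inv L * recurrenceCombination (suc k) x y (Hsh q a b c d (suc k)))
               (Hsh≡shift-s (suc (suc k))) (Hsh≡shift-s (suc k)) ⟩
    inv L * recurrenceCombination (suc k) (s (suc k)) (s k) (Hsh q a b c d (suc k))
      ≡⟨ cong (λ z → inv L * recurrenceCombination (suc k) (s (suc k)) (s k) z) (Hsh≡shift-s k) ⟩
    inv L * recurrenceCombination (suc k) (s (suc k)) (s k) (shift s k)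
      ≡⟨ sym (*-solveˡ (*-≢0 (1-cqⁱ≢0 (suc k)) (1-bqⁱ≢0 (suc (suc k)))) (s-recurrence k)) ⟩
    s (suc (suc k)) ∎
    where
    L = recurrenceCoefficient (suc k)

-- The identity also holds for k = 0.
theorem3p1 : (q a b c d : ℚ) →
    q ≢ 0ℚ → a ≢ 0ℚ → d ≢ 0ℚ →
    (∀ (i : ℕ) → 1ℚ - q ^ suc i ≢ 0ℚ) →
    (∀ (i : ℕ) → 1ℚ - b * (q ^ i) ≢ 0ℚ) →
    (∀ (i : ℕ) → 1ℚ - c * (q ^ i) ≢ 0ℚ) →
    (k : ℕ) → 1 ≤ k →
    H q a b c d k ≡ RHS q a b c d k
theorem3p1 q a b c d q≢0 a≢0 d≢0 1-qⁱ⁺¹≢0 1-bqⁱ≢0 1-cqⁱ≢0 k _ = begin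
  H q a b c d k                ≡⟨ Hsh≡shift-s (suc (suc k)) ⟩
  conv (u q a b c d) (suc k)   ≡⟨ sumTo-cong (suc k) (λ j _ → sym (*-assoc (u q a b c d j) _ _)) ⟩
  RHS q a b c d k              ∎
  where
  open Recurrence q a b c d q≢0 a≢0 d≢0 1-qⁱ⁺¹≢0 1-bqⁱ≢0 1-cqⁱ≢0 using (Hsh≡shift-s)
  open EulerConvolution q 1-qⁱ⁺¹≢0 using (conv)
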